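{- Let $q\ge 2$ be an integer. If there is no perfect difference set of size $q$ in $\mathbb{Z}_{q^2-q+1}$, then $d(n,K_q)=\infty$ for infinitely many integers $n$ with $n\equiv 1\pmod{\binom{q}{2}}$.
   Context: A subset $A\subseteq\mathbb{Z}_N$ is a perfect difference set if every nonzero element of $\mathbb{Z}_N$ can be written uniquely as $a-b$ with $a,b\in A$. An $(\ell,d)$-coloring of the complete graph $K_n$ is an edge-coloring using exactly $\ell$ colors in total such that every vertex is incident to at least $d$ edges of every color. A subgraph is rainbow if all its edges receive distinct colors. For a graph $F$ with $\ell$ edges, $d(n,F)=\infty$ if $K_n$ has an $(\ell,\lfloor (n-1)/\ell\rfloor)$-coloring without a rainbow copy of $F$; otherwise $d(n,F)$ is the smallest integer $d$ such that every $(\ell,d)$-coloring of $K_n$ contains a rainbow copy of $F$. -}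

module Defs where

open import Data.Nat using (ℕ; zero; suc; _+_; _*_; _∸_; _≤_)
open import Data.Nat.DivMod using (_/_; _%_)
open import Data.Nat.Combinatorics using (_C_)
open import Data.Fin using (Fin; toℕ; zero)
open import Data.Fin.Subset using (Subset; _∈_; ∣_∣)
open import Data.List using (length; filter)
open import Data.List using () renaming (allFin to allFinL)
open import Data.Fin.Properties using (_≟_)
open import Data.Product using (Σ; _×_; _,_; ∃)
open import Data.Sum using (_⊎_)
open import Relation.Binary.PropositionalEquality using (_≡_)
open import Relation.Nullary using (¬_)
open import Relation.Nullary.Decidable using (_×-dec_; ¬?)

diffMod : (N : ℕ) → Fin N → Fin N → ℕ
diffMod zero () _
diffMod (suc k) a b = (toℕ a + (suc k ∸ toℕ b)) % suc k

IsPerfectDifferenceSet : (N : ℕ) → Subset N → Set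
IsPerfectDifferenceSet N A =
  (x : Fin N) → ¬ (toℕ x ≡ 0) →
    Σ (Fin N × Fin N) (λ { (a , b) →
      (a ∈ A × b ∈ A × diffMod N a b ≡ toℕ x) ×
      ((a' b' : Fin N) → a' ∈ A → b' ∈ A → diffMod N a' b' ≡ toℕ x →
         (a' ≡ a × b' ≡ b)) })

HasPDS : ℕ → Set
HasPDS q = Σ (Subset (q * q ∸ q + 1)) (λ A →
  ∣ A ∣ ≡ q × IsPerfectDifferenceSet (q * q ∸ q + 1) A)

-- Edge colourings of K_n with colour set Fin ℓ.
-- A colouring is c : Fin n → Fin n → Fin ℓ, symmetric on distinct
-- vertices; values on the diagonal are irrelevant.

IsEdgeColouring : (n ℓ : ℕ) → (Fin n → Fin n → Fin ℓ) → Set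
IsEdgeColouring n ℓ c = (u v : Fin n) → ¬ (u ≡ v) → c u v ≡ c v u

colourDegree : {n ℓ : ℕ} → (Fin n → Fin n → Fin ℓ) → Fin n → Fin ℓ → ℕ
colourDegree {n} c v k =
  length (filter (λ u → ¬? (u ≟ v) ×-dec (c v u ≟ k)) (allFinL n))

IsLDColouring : (n ℓ d : ℕ) → (Fin n → Fin n → Fin ℓ) → Set
IsLDColouring n ℓ d c =
  IsEdgeColouring n ℓ c ×
  ((k : Fin ℓ) → Σ (Fin n × Fin n) (λ { (u , v) → ¬ (u ≡ v) × c u v ≡ k })) ×
  ((v : Fin n) (k : Fin ℓ) → d ≤ colourDegree c v k)

RainbowKq : (q : ℕ) {n ℓ : ℕ} → (Fin n → Fin n → Fin ℓ) → Set
RainbowKq q {n} c = Σ (Fin q → Fin n) (λ f →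
  ((i j : Fin q) → f i ≡ f j → i ≡ j) ×
  ((i j i' j' : Fin q) → ¬ (i ≡ j) → ¬ (i' ≡ j') →
     c (f i) (f j) ≡ c (f i') (f j') →
     (i ≡ i' × j ≡ j') ⊎ (i ≡ j' × j ≡ i')))

-- floor division (ℓ = 0 never occurs below, as q ≥ 2)
floorDiv : ℕ → ℕ → ℕ
floorDiv m zero = 0
floorDiv m (suc k) = m / suc k

-- d(n, K_q) = ∞ : with ℓ = (q choose 2) edges of K_q, K_n has an
-- (ℓ, ⌊(n-1)/ℓ⌋)-colouring with no rainbow K_q
dInfinityKq : (n q : ℕ) → Set
dInfinityKq n q = Σ (Fin n → Fin n → Fin (q C 2)) (λ c →
  IsLDColouring n (q C 2) (floorDiv (n ∸ 1) (q C 2)) c × ¬ RainbowKq q c)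

-- Let ℓ = q(q-1)/2 and N = 2ℓ + 1. Colour the edge {a, b} of K_N by the class of ±(a - b)
-- in ℤ_N: there are exactly ℓ classes, and every vertex has exactly two edges of each colour.
-- A rainbow K_q has ℓ edges, so it uses every colour once; hence every nonzero residue is a
-- difference of its vertices in exactly one way, i.e. its vertex set is a perfect difference set.
-- Substituting a coloured K_M for every vertex of K_N (edges between two copies keep the colour
-- of the corresponding edge of K_N) creates no new rainbow K_q: a rainbow K_q meeting some copy
-- twice but not lying inside it would contain two equally coloured edges to an outside vertex.
-- Iterating yields, for n = N^j ≡ 1 (mod ℓ), colourings of K_n without rainbow K_q in which every
-- vertex has (n - 1)/ℓ edges of every colour.

module Submission where

open import Defs


open import Data.Empty using (⊥-elim)
open import Data.Fin as Fin using (Fin; zero; suc; toℕ; fromℕ<; combine; remQuot)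
import Data.Fin.Properties as FinP
open import Data.Fin.Subset using (Subset; ∣_∣) renaming (_∈_ to _∈ₛ_)
open import Data.List using (List; []; _∷_; length; lookup; map; filter; allFin; tabulate; _++_; cartesianProductWith)
open import Data.List.Properties using (length-++; length-map; length-tabulate)
open import Data.List.Membership.Propositional using (_∈_)
open import Data.List.Membership.Propositional.Properties
  using (∈-lookup; ∈-allFin; ∈-filter⁺; ∈-filter⁻; ∈-map⁻; ∈-tabulate⁺; ∈-tabulate⁻; ∈-++⁻; ∈-cartesianProductWith⁻)
open import Data.List.Membership.Setoid.Properties using (index-injective)
open import Data.List.Relation.Binary.Subset.Propositional using (_⊆_)
open import Data.List.Relation.Unary.All as All using (All; []; _∷_)
import Data.List.Relation.Unary.All.Properties as AllP
open import Data.List.Relation.Unary.AllPairs using ([]; _∷_)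
open import Data.List.Relation.Unary.Any using (here; there; index; any?)
open import Data.List.Relation.Unary.Unique.Propositional using (Unique)
import Data.List.Relation.Unary.Unique.Propositional.Properties as UniqueP
open import Data.Nat
open import Data.Nat.Combinatorics using (_C_; nC1≡n; nCk+nC[k+1]≡[n+1]C[k+1])
open import Data.Nat.DivMod using (_%_; _/_; _mod_; m*n/n≡m; [m+n]%n≡m%n; m<n⇒m%n≡m; m%n<n)
open import Data.Nat.Properties
open import Data.Nat.Tactic.RingSolver using (solve-∀)
open import Data.Product as Product using (Σ; ∃; ∃₂; _×_; _,_; proj₁; proj₂)
open import Data.Product.Properties using (,-injectiveˡ; ,-injectiveʳ)
open import Data.Sum using (_⊎_; inj₁; inj₂; [_,_])
import Data.Vec as Vec
open import Data.Vec.Properties using (lookup∘tabulate; []=⇒lookup; lookup⇒[]=)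
open import Function using (_∘_)
open import Relation.Binary.Definitions using (tri<; tri≈; tri>)
open import Relation.Binary.PropositionalEquality
  using (_≡_; refl; sym; trans; cong; cong₂; subst; setoid; module ≡-Reasoning)
open import Relation.Nullary using (¬_; yes; no; does; contradiction)
open import Relation.Nullary.Decidable using (¬?; _×-dec_; dec-true)
open import Relation.Unary using (Decidable)

private variable
  A B D : Set
  n : ℕ

lookup-injective : {xs : List A} → Unique xs → ∀ i j → lookup xs i ≡ lookup xs j → i ≡ j
lookup-injective {xs = _ ∷ _} _         zero    zero    _ = refl
lookup-injective {xs = _ ∷ _} (x∉ ∷ _) zero    (suc j) e = ⊥-elim (All.lookup x∉ (∈-lookup j) e)
lookup-injective {xs = _ ∷ _} (x∉ ∷ _) (suc i) zero    e = ⊥-elim (All.lookup x∉ (∈-lookup i) (sym e))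
lookup-injective {xs = _ ∷ _} (_ ∷ u)  (suc i) (suc j) e = cong suc (lookup-injective u i j e)

Unique⇒length≤ : {xs ys : List A} → Unique xs → xs ⊆ ys → length xs ≤ length ys
Unique⇒length≤ {A = A} {xs} {ys} u xs⊆ys with length xs ≤? length ys
... | yes xs≤ys = xs≤ys
... | no xs≰ys with i , j , i<j , e ← FinP.pigeonhole (≰⇒> xs≰ys) (λ i → index (xs⊆ys (∈-lookup i)))
  = contradiction (lookup-injective u i j (index-injective (setoid A) (xs⊆ys (∈-lookup i)) (xs⊆ys (∈-lookup j)) e))
                  (FinP.<⇒≢ i<j)

length-allFin : ∀ n → length (allFin n) ≡ n
length-allFin n = length-tabulate (λ i → i)

Unique⇒∈ : {xs : List (Fin n)} → Unique xs → n ≤ length xs → (k : Fin n) → k ∈ xs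
Unique⇒∈ {n} {xs} u n≤xs k with any? (k FinP.≟_) xs
... | yes k∈xs = k∈xs
-- otherwise k ∷ xs would be a duplicate-free list of n + 1 elements of Fin n
... | no k∉xs = contradiction
  (≤-trans (Unique⇒length≤ (AllP.¬Any⇒All¬ xs k∉xs ∷ u) (λ _ → ∈-allFin _)) (≤-reflexive (length-allFin n)))
  (<⇒≱ (s≤s n≤xs))

map⁺-injectiveOn : {f : A → B} {xs : List A} → Unique xs →
  (∀ {x y} → x ∈ xs → y ∈ xs → f x ≡ f y → x ≡ y) → Unique (map f xs)
map⁺-injectiveOn {xs = []}    []        _   = []
map⁺-injectiveOn {xs = _ ∷ _} (x∉ ∷ u) inj =
  AllP.map⁺ (All.tabulate (λ y∈ fx≡fy → All.lookup x∉ y∈ (inj (here refl) (there y∈) fx≡fy)))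
  ∷ map⁺-injectiveOn u (λ x∈ y∈ → inj (there x∈) (there y∈))

length-cartesianProductWith : (f : A → B → D) (xs : List A) (ys : List B) →
  length (cartesianProductWith f xs ys) ≡ length xs * length ys
length-cartesianProductWith f []       ys = refl
length-cartesianProductWith f (x ∷ xs) ys = begin
  length (map (f x) ys ++ cartesianProductWith f xs ys)         ≡⟨ length-++ (map (f x) ys) ⟩
  length (map (f x) ys) + length (cartesianProductWith f xs ys) ≡⟨ cong₂ _+_ (length-map (f x) ys) (length-cartesianProductWith f xs ys) ⟩
  length ys + length xs * length ys                             ∎
  where open ≡-Reasoning

[1+n]C2≡n+nC2 : ∀ n → suc n C 2 ≡ n + n C 2
[1+n]C2≡n+nC2 n = trans (sym (nCk+nC[k+1]≡[n+1]C[k+1] n 1)) (cong (_+ n C 2) (nC1≡n n))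

nC2+nC2+n≡n*n : ∀ n → n C 2 + n C 2 + n ≡ n * n
nC2+nC2+n≡n*n zero    = refl
nC2+nC2+n≡n*n (suc n) = begin
  suc n C 2 + suc n C 2 + suc n        ≡⟨ cong (λ x → x + x + suc n) ([1+n]C2≡n+nC2 n) ⟩
  (n + n C 2) + (n + n C 2) + suc n    ≡⟨ regroup (n C 2) n ⟩
  (n C 2 + n C 2 + n) + suc (n + n)    ≡⟨ cong (_+ suc (n + n)) (nC2+nC2+n≡n*n n) ⟩
  n * n + suc (n + n)                  ≡⟨ square n ⟩
  suc n * suc n                        ∎
  where
  open ≡-Reasoning
  regroup : ∀ c n → (n + c) + (n + c) + suc n ≡ (c + c + n) + suc (n + n)
  regroup = solve-∀
  square : ∀ n → n * n + suc (n + n) ≡ suc n * suc n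
  square = solve-∀

n*n∸n+1≡1+nC2+nC2 : ∀ n → n * n ∸ n + 1 ≡ suc (n C 2 + n C 2)
n*n∸n+1≡1+nC2+nC2 n = begin
  n * n ∸ n + 1                  ≡⟨ +-comm (n * n ∸ n) 1 ⟩
  suc (n * n ∸ n)                ≡⟨ cong (λ x → suc (x ∸ n)) (nC2+nC2+n≡n*n n) ⟨
  suc (n C 2 + n C 2 + n ∸ n)    ≡⟨ cong suc (m+n∸n≡m (n C 2 + n C 2) n) ⟩
  suc (n C 2 + n C 2)            ∎
  where open ≡-Reasoning

nC2>0 : ∀ {n} → 2 ≤ n → 0 < n C 2
nC2>0 {suc n} (s≤s 1≤n) = subst (0 <_) (sym ([1+n]C2≡n+nC2 n)) (≤-trans 1≤n (m≤m+n n (n C 2)))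

floorDiv≡/ : ∀ m n .{{_ : NonZero n}} → floorDiv m n ≡ m / n
floorDiv≡/ m (suc n) = refl

ColourNeighbour : {ℓ : ℕ} → (Fin n → Fin n → Fin ℓ) → Fin n → Fin ℓ → Fin n → Set
ColourNeighbour c v k u = ¬ (u ≡ v) × c v u ≡ k

neighbours : {ℓ : ℕ} → (Fin n → Fin n → Fin ℓ) → Fin n → Fin ℓ → List (Fin n)
neighbours {n} c v k = filter (λ u → ¬? (u FinP.≟ v) ×-dec (c v u FinP.≟ k)) (allFin n)

module _ {ℓ : ℕ} (c : Fin n → Fin n → Fin ℓ) (v : Fin n) (k : Fin ℓ) where

  neighbours-unique : Unique (neighbours c v k)
  neighbours-unique = UniqueP.filter⁺ _ (UniqueP.allFin⁺ n)

  neighbours-colour : All (ColourNeighbour c v k) (neighbours c v k)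
  neighbours-colour = AllP.all-filter _ (allFin n)

  colourDegree-lowerBound : {us : List (Fin n)} → Unique us → All (ColourNeighbour c v k) us →
    length us ≤ colourDegree c v k
  colourDegree-lowerBound u all = Unique⇒length≤ u (λ u∈ → ∈-filter⁺ _ (∈-allFin _) (All.lookup all u∈))

isLDColouring : {ℓ d : ℕ} {c : Fin n → Fin n → Fin ℓ} → IsEdgeColouring n ℓ c →
  (∀ v k → d ≤ colourDegree c v k) → 1 ≤ d → Fin n → IsLDColouring n ℓ d c
isLDColouring {n} {ℓ} {c = c} sym-c deg 1≤d v =
  sym-c , (λ k → (v , neighbour k) , (λ v≡u → proj₁ (neighbour-colour k) (sym v≡u)) , proj₂ (neighbour-colour k)) , deg
  where
  first : ∀ k → Fin (length (neighbours c v k))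
  first k = fromℕ< (≤-trans 1≤d (deg v k))
  neighbour : Fin ℓ → Fin n
  neighbour k = lookup (neighbours c v k) (first k)
  neighbour-colour : ∀ k → ColourNeighbour c v k (neighbour k)
  neighbour-colour k = All.lookup (neighbours-colour c v k) (∈-lookup (first k))

Rainbow : {q ℓ : ℕ} → (Fin n → Fin n → Fin ℓ) → (Fin q → Fin n) → Set
Rainbow {q = q} c f = (i j i' j' : Fin q) → ¬ (i ≡ j) → ¬ (i' ≡ j') →
  c (f i) (f j) ≡ c (f i') (f j') → (i ≡ i' × j ≡ j') ⊎ (i ≡ j' × j ≡ i')

increasingPairs : ∀ q → List (Fin q × Fin q)
increasingPairs zero    = []
increasingPairs (suc q) = map (λ j → zero , suc j) (allFin q) ++ map (Product.map suc suc) (increasingPairs q)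

length-increasingPairs : ∀ q → length (increasingPairs q) ≡ q C 2
length-increasingPairs zero    = refl
length-increasingPairs (suc q) = begin
  length (map _ (allFin q) ++ map _ (increasingPairs q))           ≡⟨ length-++ (map (λ j → zero {q} , suc j) (allFin q)) ⟩
  length (map _ (allFin q)) + length (map _ (increasingPairs q))   ≡⟨ cong₂ _+_ (trans (length-map _ (allFin q)) (length-allFin q))
                                                                                  (trans (length-map _ (increasingPairs q)) (length-increasingPairs q)) ⟩
  q + q C 2                                                         ≡⟨ cong (_+ q C 2) (sym (nC1≡n q)) ⟩
  q C 1 + q C 2                                                     ≡⟨ nCk+nC[k+1]≡[n+1]C[k+1] q 1 ⟩
  suc q C 2                                                         ∎
  where open ≡-Reasoning

increasingPairs-< : ∀ q {p} → p ∈ increasingPairs q → proj₁ p Fin.< proj₂ p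
increasingPairs-< (suc q) p∈ with ∈-++⁻ (map (λ j → zero {q} , suc j) (allFin q)) p∈
... | inj₁ p∈₁ with _ , _ , refl ← ∈-map⁻ (λ j → zero {q} , suc j) p∈₁ = s≤s z≤n
... | inj₂ p∈₂ with p' , p'∈ , refl ← ∈-map⁻ (Product.map suc suc) p∈₂ = s≤s (increasingPairs-< q p'∈)

increasingPairs-unique : ∀ q → Unique (increasingPairs q)
increasingPairs-unique zero    = []
increasingPairs-unique (suc q) = UniqueP.++⁺
  (UniqueP.map⁺ (FinP.suc-injective ∘ ,-injectiveʳ) (UniqueP.allFin⁺ q))
  (UniqueP.map⁺ (λ e → cong₂ _,_ (FinP.suc-injective (,-injectiveˡ e)) (FinP.suc-injective (,-injectiveʳ e)))
                (increasingPairs-unique q))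
  disjoint
  where
  disjoint : ∀ {p} → ¬ (p ∈ map (λ j → zero {q} , suc j) (allFin q) × p ∈ map (Product.map suc suc) (increasingPairs q))
  disjoint (p∈₁ , p∈₂) with _ , _ , refl ← ∈-map⁻ (λ j → zero {q} , suc j) p∈₁
                          | _ , _ , ()   ← ∈-map⁻ (Product.map suc suc) p∈₂

pairColour : {q ℓ : ℕ} → (Fin n → Fin n → Fin ℓ) → (Fin q → Fin n) → Fin q × Fin q → Fin ℓ
pairColour c f (i , j) = c (f i) (f j)

rainbow⇒pairColours-unique : {q ℓ : ℕ} (c : Fin n → Fin n → Fin ℓ) (f : Fin q → Fin n) → Rainbow c f →
  Unique (map (pairColour c f) (increasingPairs q))
rainbow⇒pairColours-unique {q = q} c f rainbow = map⁺-injectiveOn (increasingPairs-unique q) injective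
  where
  injective : ∀ {p p'} → p ∈ increasingPairs q → p' ∈ increasingPairs q → pairColour c f p ≡ pairColour c f p' → p ≡ p'
  injective {i , j} {i' , j'} p∈ p'∈ e
    with rainbow i j i' j' (FinP.<⇒≢ (increasingPairs-< q p∈)) (FinP.<⇒≢ (increasingPairs-< q p'∈)) e
  ... | inj₁ (refl , refl) = refl
  ... | inj₂ (refl , refl) = ⊥-elim (FinP.<-asym (increasingPairs-< q p∈) (increasingPairs-< q p'∈))

rainbow⇒allColours : {q ℓ : ℕ} (c : Fin n → Fin n → Fin ℓ) (f : Fin q → Fin n) → ℓ ≤ q C 2 → Rainbow c f →
  (k : Fin ℓ) → ∃₂ λ i j → ¬ (i ≡ j) × c (f i) (f j) ≡ k
rainbow⇒allColours {q = q} {ℓ} c f ℓ≤ rainbow k =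
  let (i , j) , p∈ , k≡ = ∈-map⁻ (pairColour c f) (Unique⇒∈ (rainbow⇒pairColours-unique c f rainbow) ℓ≤pairs k)
  in i , j , FinP.<⇒≢ (increasingPairs-< q p∈) , sym k≡
  where
  ℓ≤pairs : ℓ ≤ length (map (pairColour c f) (increasingPairs q))
  ℓ≤pairs = ≤-trans ℓ≤ (≤-reflexive (sym (trans (length-map _ (increasingPairs q)) (length-increasingPairs q))))

Rainbow-transfer : {m q ℓ : ℕ} {c : Fin n → Fin n → Fin ℓ} {d : Fin m → Fin m → Fin ℓ} {f : Fin q → Fin n} {g : Fin q → Fin m} →
  (∀ {i j} → ¬ (i ≡ j) → d (g i) (g j) ≡ c (f i) (f j)) → Rainbow c f → Rainbow d g
Rainbow-transfer same rainbow i j i' j' i≢j i'≢j' e = rainbow i j i' j' i≢j i'≢j' (trans (sym (same i≢j)) (trans e (same i'≢j')))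

∣tabulate-does∣ : {X : Set} {P : X → Set} (P? : Decidable P) (h : Fin n → X) →
  ∣ Vec.tabulate (does ∘ P? ∘ h) ∣ ≡ length (filter P? (tabulate h))
∣tabulate-does∣ {zero}  P? h = refl
∣tabulate-does∣ {suc n} P? h with P? (h zero)
... | yes _ = cong suc (∣tabulate-does∣ P? (h ∘ suc))
... | no  _ = ∣tabulate-does∣ P? (h ∘ suc)

module _ {q : ℕ} (f : Fin q → Fin n) where

  private
    InImage : Fin n → Set
    InImage y = ∃ λ i → f i ≡ y

    inImage? : Decidable InImage
    inImage? y = FinP.any? (λ i → f i FinP.≟ y)

  image : Subset n
  image = Vec.tabulate (does ∘ inImage?)

  ∈-image⁺ : ∀ i → f i ∈ₛ image
  ∈-image⁺ i = lookup⇒[]= (f i) image (trans (lookup∘tabulate _ (f i)) (dec-true (inImage? (f i)) (i , refl)))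

  ∈-image⁻ : ∀ {y} → y ∈ₛ image → InImage y
  ∈-image⁻ {y} y∈ with inImage? y | trans (sym (lookup∘tabulate _ y)) ([]=⇒lookup y∈)
  ... | yes inImage | _ = inImage

  ∣image∣ : (∀ {i j} → f i ≡ f j → i ≡ j) → ∣ image ∣ ≡ q
  ∣image∣ injective = trans (∣tabulate-does∣ inImage? (λ y → y)) (≤-antisym image≤q q≤image)
    where
    imageList : List (Fin n)
    imageList = filter inImage? (allFin n)
    image≤q : length imageList ≤ q
    image≤q = subst (length imageList ≤_) (length-tabulate f)
      (Unique⇒length≤ (UniqueP.filter⁺ inImage? (UniqueP.allFin⁺ n))
        (λ y∈ → let i , fi≡y = proj₂ (∈-filter⁻ inImage? {xs = allFin n} y∈) in subst (_∈ tabulate f) fi≡y (∈-tabulate⁺ i)))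
    q≤image : q ≤ length imageList
    q≤image = subst (_≤ length imageList) (length-tabulate f)
      (Unique⇒length≤ (UniqueP.tabulate⁺ injective)
        (λ fi∈ → let i , fi≡ = ∈-tabulate⁻ fi∈ in ∈-filter⁺ inImage? (∈-allFin _) (i , sym fi≡)))

remQuot-injective : ∀ {N} M {u v : Fin (N * M)} → remQuot {N} M u ≡ remQuot M v → u ≡ v
remQuot-injective {N} M {u} {v} e =
  trans (sym (FinP.combine-remQuot {N} M u)) (trans (cong (Product.uncurry combine) e) (FinP.combine-remQuot {N} M v))

module _ {N M ℓ : ℕ} where

  lex : (Fin N → Fin N → Fin ℓ) → (Fin M → Fin M → Fin ℓ) → Fin N × Fin M → Fin N × Fin M → Fin ℓ
  lex c c' (a , x) (b , y) with a FinP.≟ b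
  ... | yes _ = c' x y
  ... | no  _ = c a b

  _⊗_ : (Fin N → Fin N → Fin ℓ) → (Fin M → Fin M → Fin ℓ) → Fin (N * M) → Fin (N * M) → Fin ℓ
  (c ⊗ c') u v = lex c c' (remQuot M u) (remQuot M v)

  module _ {c : Fin N → Fin N → Fin ℓ} {c' : Fin M → Fin M → Fin ℓ} where

    lex-inner : ∀ p p' → proj₁ p ≡ proj₁ p' → lex c c' p p' ≡ c' (proj₂ p) (proj₂ p')
    lex-inner (a , x) (b , y) a≡b with a FinP.≟ b
    ... | yes _   = refl
    ... | no a≢b = contradiction a≡b a≢b

    lex-outer : ∀ p p' → ¬ (proj₁ p ≡ proj₁ p') → lex c c' p p' ≡ c (proj₁ p) (proj₁ p')
    lex-outer (a , x) (b , y) a≢b with a FinP.≟ b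
    ... | yes a≡b = contradiction a≡b a≢b
    ... | no _    = refl

    ⊗-combine : ∀ a x b y → (c ⊗ c') (combine a x) (combine b y) ≡ lex c c' (a , x) (b , y)
    ⊗-combine a x b y = cong₂ (lex c c') (FinP.remQuot-combine a x) (FinP.remQuot-combine b y)

    ⊗-isEdgeColouring : IsEdgeColouring N ℓ c → IsEdgeColouring M ℓ c' → IsEdgeColouring (N * M) ℓ (c ⊗ c')
    ⊗-isEdgeColouring sym-c sym-c' u v u≢v = lex-sym (remQuot M u) (remQuot M v) (u≢v ∘ remQuot-injective M)
      where
      lex-sym : ∀ p p' → ¬ (p ≡ p') → lex c c' p p' ≡ lex c c' p' p
      lex-sym (a , x) (b , y) p≢p' with a FinP.≟ b
      ... | yes refl = trans (sym-c' x y (p≢p' ∘ cong (a ,_))) (sym (lex-inner (a , y) (a , x) refl))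
      ... | no a≢b   = trans (sym-c a b a≢b) (sym (lex-outer (b , y) (a , x) (a≢b ∘ sym)))

    ⊗-colourDegree : ∀ {d₁ d₂} a x k → d₁ ≤ colourDegree c a k → d₂ ≤ colourDegree c' x k →
      d₁ * M + d₂ ≤ colourDegree (c ⊗ c') (combine a x) k
    ⊗-colourDegree {d₁} {d₂} a x k d₁≤ d₂≤ = begin
      d₁ * M + d₂                                     ≤⟨ +-mono-≤ (*-monoˡ-≤ M d₁≤) d₂≤ ⟩
      colourDegree c a k * M + colourDegree c' x k    ≡⟨ length-us ⟨
      length (outer ++ inner)                         ≤⟨ colourDegree-lowerBound (c ⊗ c') (combine a x) k us-unique us-colour ⟩
      colourDegree (c ⊗ c') (combine a x) k           ∎
      where
      open ≤-Reasoning
      outer inner : List (Fin (N * M))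
      outer = cartesianProductWith combine (neighbours c a k) (allFin M)
      inner = map (combine a) (neighbours c' x k)

      length-us : length (outer ++ inner) ≡ colourDegree c a k * M + colourDegree c' x k
      length-us = trans (length-++ outer) (cong₂ _+_
        (trans (length-cartesianProductWith combine (neighbours c a k) (allFin M)) (cong (colourDegree c a k *_) (length-allFin M)))
        (length-map (combine a) (neighbours c' x k)))

      outer-colour : ∀ {u} → u ∈ outer → ColourNeighbour (c ⊗ c') (combine a x) k u
      outer-colour u∈ with b , y , b∈ , _ , refl ← ∈-cartesianProductWith⁻ combine (neighbours c a k) (allFin M) u∈ =
        let b≢a , cab≡k = All.lookup (neighbours-colour c a k) b∈ in
        b≢a ∘ FinP.combine-injectiveˡ b y a x ,
        trans (⊗-combine a x b y) (trans (lex-outer (a , x) (b , y) (b≢a ∘ sym)) cab≡k)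

      inner-colour : ∀ {y} → ColourNeighbour c' x k y → ColourNeighbour (c ⊗ c') (combine a x) k (combine a y)
      inner-colour {y} (y≢x , c'xy≡k) =
        y≢x ∘ FinP.combine-injectiveʳ a y a x ,
        trans (⊗-combine a x a y) (trans (lex-inner (a , x) (a , y) refl) c'xy≡k)

      us-colour : All (ColourNeighbour (c ⊗ c') (combine a x) k) (outer ++ inner)
      us-colour = AllP.++⁺ (All.tabulate outer-colour) (AllP.map⁺ (All.map inner-colour (neighbours-colour c' x k)))

      disjoint : ∀ {u} → ¬ (u ∈ outer × u ∈ inner)
      disjoint (u∈outer , u∈inner)
        with b , y , b∈ , _ , refl ← ∈-cartesianProductWith⁻ combine (neighbours c a k) (allFin M) u∈outer
           | y' , _ , e ← ∈-map⁻ (combine a) u∈inner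
        = proj₁ (All.lookup (neighbours-colour c a k) b∈) (FinP.combine-injectiveˡ b y a y' e)

      us-unique : Unique (outer ++ inner)
      us-unique = UniqueP.++⁺
        (UniqueP.cartesianProductWith⁺ combine
           (λ {b} {b'} {y} {y'} e → FinP.combine-injectiveˡ b y b' y' e , FinP.combine-injectiveʳ b y b' y' e)
           (neighbours-unique c a k) (UniqueP.allFin⁺ M))
        (UniqueP.map⁺ (FinP.combine-injectiveʳ a _ a _) (neighbours-unique c' x k))
        disjoint

    module _ {q : ℕ} (f : Fin q → Fin (N * M)) (f-injective : ∀ i j → f i ≡ f j → i ≡ j) (rainbow : Rainbow (c ⊗ c') f) where

      private
        block : Fin q → Fin N
        block i = proj₁ (remQuot {N} M (f i))

        position : Fin q → Fin M
        position i = proj₂ (remQuot {N} M (f i))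

        colour-inner : ∀ {i j} → block i ≡ block j → (c ⊗ c') (f i) (f j) ≡ c' (position i) (position j)
        colour-inner {i} {j} = lex-inner (remQuot {N} M (f i)) (remQuot {N} M (f j))

        colour-outer : ∀ {i j} → ¬ (block i ≡ block j) → (c ⊗ c') (f i) (f j) ≡ c (block i) (block j)
        colour-outer {i} {j} = lex-outer (remQuot {N} M (f i)) (remQuot {N} M (f j))

      ⊗-rainbow-inner : (∀ i j → block i ≡ block j) → RainbowKq q c'
      ⊗-rainbow-inner sameBlock =
        position ,
        (λ i j e → f-injective i j (remQuot-injective M (cong₂ _,_ (sameBlock i j) e))) ,
        Rainbow-transfer {c = c ⊗ c'} {d = c'} {f = f} {g = position} (λ {i} {j} _ → sym (colour-inner (sameBlock i j))) rainbow

      ⊗-rainbow-outer : ∀ w w' → ¬ (block w ≡ block w') → RainbowKq q c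
      ⊗-rainbow-outer w w' bw≢bw' =
        block , block-injective ,
        Rainbow-transfer {c = c ⊗ c'} {d = c} {f = f} {g = block} (λ i≢j → sym (colour-outer (i≢j ∘ block-injective _ _))) rainbow
        where
        otherBlock : ∀ i → ∃ λ v → ¬ (block v ≡ block i)
        otherBlock i with block w FinP.≟ block i
        ... | yes bw≡bi = w' , λ bw'≡bi → bw≢bw' (trans bw≡bi (sym bw'≡bi))
        ... | no bw≢bi  = w , bw≢bi

        distinct : ∀ {i v} → ¬ (block v ≡ block i) → ¬ (i ≡ v)
        distinct bv≢bi i≡v = bv≢bi (cong block (sym i≡v))

        sameColour : ∀ {i j v} → block i ≡ block j → ¬ (block v ≡ block i) →
          (c ⊗ c') (f i) (f v) ≡ (c ⊗ c') (f j) (f v)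
        sameColour {i} {j} {v} bi≡bj bv≢bi = begin
          (c ⊗ c') (f i) (f v)   ≡⟨ colour-outer (bv≢bi ∘ sym) ⟩
          c (block i) (block v)  ≡⟨ cong (λ b → c b (block v)) bi≡bj ⟩
          c (block j) (block v)  ≡⟨ colour-outer (λ bj≡bv → bv≢bi (trans (sym bj≡bv) (sym bi≡bj))) ⟨
          (c ⊗ c') (f j) (f v)   ∎
          where open ≡-Reasoning

        block-injective : ∀ i j → block i ≡ block j → i ≡ j
        block-injective i j bi≡bj with v , bv≢bi ← otherBlock i
          with rainbow i v j v (distinct bv≢bi) (distinct (λ bv≡bj → bv≢bi (trans bv≡bj (sym bi≡bj)))) (sameColour bi≡bj bv≢bi)
        ... | inj₁ (i≡j , _) = i≡j
        ... | inj₂ (i≡v , _) = contradiction i≡v (distinct bv≢bi)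

      splitRainbow : RainbowKq q c ⊎ RainbowKq q c'
      splitRainbow with FinP.all? (λ i → FinP.all? (λ j → block i FinP.≟ block j))
      ... | yes sameBlock = inj₂ (⊗-rainbow-inner sameBlock)
      ... | no ¬sameBlock =
        let w , ¬∀w' = FinP.¬∀⟶∃¬ q _ (λ i → FinP.all? (λ j → block i FinP.≟ block j)) ¬sameBlock
            w' , bw≢bw' = FinP.¬∀⟶∃¬ q _ (λ j → block w FinP.≟ block j) ¬∀w'
        in inj₁ (⊗-rainbow-outer w w' bw≢bw')

    ⊗-rainbow : {q : ℕ} → RainbowKq q (c ⊗ c') → RainbowKq q c ⊎ RainbowKq q c'
    ⊗-rainbow (f , f-injective , rainbow) = splitRainbow f f-injective rainbow

module _ {k : ℕ} where

  private
    N : ℕ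
    N = suc k

  private
    ∸-+-∸ : ∀ x {y} → y ≤ N → N ∸ (x + (N ∸ y)) ≡ y ∸ x
    ∸-+-∸ x {y} y≤N = begin
      N ∸ (x + (N ∸ y)) ≡⟨ cong (N ∸_) (+-comm x (N ∸ y)) ⟩
      N ∸ ((N ∸ y) + x) ≡⟨ ∸-+-assoc N (N ∸ y) x ⟨
      N ∸ (N ∸ y) ∸ x   ≡⟨ cong (_∸ x) (m∸[m∸n]≡n y≤N) ⟩
      y ∸ x             ∎
      where open ≡-Reasoning

    +-∸<N : ∀ {x y} → x < y → y ≤ N → x + (N ∸ y) < N
    +-∸<N {x} {y} x<y y≤N = begin-strict
      x + (N ∸ y) <⟨ +-monoˡ-< (N ∸ y) x<y ⟩
      y + (N ∸ y) ≡⟨ m+[n∸m]≡n y≤N ⟩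
      N           ∎
      where open ≤-Reasoning

  diffMod-≥ : (a b : Fin N) → toℕ b ≤ toℕ a → diffMod N a b ≡ toℕ a ∸ toℕ b
  diffMod-≥ a b b≤a = begin
    (x + (N ∸ y)) % N     ≡⟨ cong (_% N) wrap ⟩
    ((x ∸ y) + N) % N     ≡⟨ [m+n]%n≡m%n (x ∸ y) N ⟩
    (x ∸ y) % N           ≡⟨ m<n⇒m%n≡m (≤-<-trans (m∸n≤m x y) (FinP.toℕ<n a)) ⟩
    x ∸ y                 ∎
    where
    open ≡-Reasoning
    x y : ℕ
    x = toℕ a
    y = toℕ b
    wrap : x + (N ∸ y) ≡ (x ∸ y) + N
    wrap = begin
      x + (N ∸ y)             ≡⟨ cong (_+ (N ∸ y)) (m∸n+n≡m b≤a) ⟨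
      (x ∸ y + y) + (N ∸ y)   ≡⟨ +-assoc (x ∸ y) y (N ∸ y) ⟩
      (x ∸ y) + (y + (N ∸ y)) ≡⟨ cong ((x ∸ y) +_) (m+[n∸m]≡n (<⇒≤ (FinP.toℕ<n b))) ⟩
      (x ∸ y) + N             ∎

  diffMod-< : (a b : Fin N) → toℕ a < toℕ b → diffMod N a b ≡ toℕ a + (N ∸ toℕ b)
  diffMod-< a b a<b = m<n⇒m%n≡m (+-∸<N a<b (<⇒≤ (FinP.toℕ<n b)))

  diffMod<N : (a b : Fin N) → diffMod N a b < N
  diffMod<N a b = m%n<n (toℕ a + (N ∸ toℕ b)) N

  diffMod-self : (a : Fin N) → diffMod N a a ≡ 0
  diffMod-self a = trans (diffMod-≥ a a ≤-refl) (n∸n≡0 (toℕ a))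

  private
    diffMod-swap-< : (a b : Fin N) → toℕ a < toℕ b → diffMod N b a ≡ N ∸ diffMod N a b
    diffMod-swap-< a b a<b = begin
      diffMod N b a              ≡⟨ diffMod-≥ b a (<⇒≤ a<b) ⟩
      toℕ b ∸ toℕ a              ≡⟨ ∸-+-∸ (toℕ a) (<⇒≤ (FinP.toℕ<n b)) ⟨
      N ∸ (toℕ a + (N ∸ toℕ b))  ≡⟨ cong (N ∸_) (diffMod-< a b a<b) ⟨
      N ∸ diffMod N a b          ∎
      where open ≡-Reasoning

  diffMod-swap : (a b : Fin N) → ¬ (a ≡ b) → diffMod N b a ≡ N ∸ diffMod N a b
  diffMod-swap a b a≢b with <-cmp (toℕ a) (toℕ b)
  ... | tri< a<b _ _ = diffMod-swap-< a b a<b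
  ... | tri≈ _ a≡b _ = contradiction (FinP.toℕ-injective a≡b) a≢b
  ... | tri> _ _ b<a = begin
    diffMod N b a             ≡⟨ m∸[m∸n]≡n (<⇒≤ (diffMod<N b a)) ⟨
    N ∸ (N ∸ diffMod N b a)   ≡⟨ cong (N ∸_) (diffMod-swap-< b a b<a) ⟨
    N ∸ diffMod N a b         ∎
    where open ≡-Reasoning

  diffMod>0 : (a b : Fin N) → ¬ (a ≡ b) → 0 < diffMod N a b
  diffMod>0 a b a≢b = n≢0⇒n>0 λ d≡0 →
    <-irrefl refl (subst (_< N) (trans (diffMod-swap a b a≢b) (cong (N ∸_) d≡0)) (diffMod<N b a))

  diffMod-surjective : (a : Fin N) (δ : ℕ) → δ < N → ∃ λ b → diffMod N a b ≡ δ
  diffMod-surjective a δ δ<N with δ ≤? toℕ a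
  ... | yes δ≤a = b , (begin
    diffMod N a b          ≡⟨ diffMod-≥ a b (subst (_≤ toℕ a) (sym toℕ-b) (m∸n≤m (toℕ a) δ)) ⟩
    toℕ a ∸ toℕ b          ≡⟨ cong (toℕ a ∸_) toℕ-b ⟩
    toℕ a ∸ (toℕ a ∸ δ)    ≡⟨ m∸[m∸n]≡n δ≤a ⟩
    δ                      ∎)
    where
    open ≡-Reasoning
    b : Fin N
    b = fromℕ< (≤-<-trans (m∸n≤m (toℕ a) δ) (FinP.toℕ<n a))
    toℕ-b : toℕ b ≡ toℕ a ∸ δ
    toℕ-b = FinP.toℕ-fromℕ< _
  ... | no δ≰a = b , (begin
    diffMod N a b                      ≡⟨ diffMod-< a b a<b ⟩
    toℕ a + (N ∸ toℕ b)                ≡⟨ cong (λ y → toℕ a + (N ∸ y)) toℕ-b ⟩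
    toℕ a + (N ∸ (toℕ a + (N ∸ δ)))    ≡⟨ cong (toℕ a +_) (∸-+-∸ (toℕ a) (<⇒≤ δ<N)) ⟩
    toℕ a + (δ ∸ toℕ a)                ≡⟨ m+[n∸m]≡n (<⇒≤ (≰⇒> δ≰a)) ⟩
    δ                                  ∎)
    where
    open ≡-Reasoning
    b : Fin N
    b = fromℕ< (+-∸<N (≰⇒> δ≰a) (<⇒≤ δ<N))
    toℕ-b : toℕ b ≡ toℕ a + (N ∸ δ)
    toℕ-b = FinP.toℕ-fromℕ< _
    a<b : toℕ a < toℕ b
    a<b = subst (toℕ a <_) (sym toℕ-b) (m<m+n (toℕ a) (m<n⇒0<n∸m δ<N))

module DifferenceColouring (ℓ : ℕ) .{{_ : NonZero ℓ}} where

  N : ℕ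
  N = suc (ℓ + ℓ)

  distance : ℕ → ℕ
  distance x = x ⊓ (N ∸ x)

  distance-reflect : ∀ {x} → x ≤ N → distance (N ∸ x) ≡ distance x
  distance-reflect {x} x≤N = trans (cong ((N ∸ x) ⊓_) (m∸[m∸n]≡n x≤N)) (⊓-comm (N ∸ x) x)

  distance>0 : ∀ {x} → 0 < x → x < N → 0 < distance x
  distance>0 0<x x<N = ⊓-glb 0<x (m<n⇒0<n∸m x<N)

  distance≤ℓ : ∀ {x} → x ≤ N → distance x ≤ ℓ
  distance≤ℓ {x} x≤N with distance x ≤? ℓ
  ... | yes d≤ℓ = d≤ℓ
  ... | no d≰ℓ = contradiction (+-mono-≤ (≰⇒> d≰ℓ) (≰⇒> d≰ℓ)) (<⇒≱ (begin-strict
    distance x + distance x  ≤⟨ +-mono-≤ (m⊓n≤m x (N ∸ x)) (m⊓n≤n x (N ∸ x)) ⟩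
    x + (N ∸ x)              ≡⟨ m+[n∸m]≡n x≤N ⟩
    N                        <⟨ n<1+n N ⟩
    suc (suc (ℓ + ℓ))        ≡⟨ cong suc (+-suc ℓ ℓ) ⟨
    suc ℓ + suc ℓ            ∎))
    where open ≤-Reasoning

  distance-injective : ∀ {x y} → x ≤ N → y ≤ N → distance x ≡ distance y → y ≡ x ⊎ y ≡ N ∸ x
  distance-injective {x} {y} x≤N y≤N dx≡dy with ⊓-sel x (N ∸ x) | ⊓-sel y (N ∸ y)
  ... | inj₁ dx≡x     | inj₁ dy≡y     = inj₁ (trans (sym dy≡y) (trans (sym dx≡dy) dx≡x))
  ... | inj₂ dx≡N∸x   | inj₂ dy≡N∸y   = inj₁ (∸-cancelˡ-≡ y≤N x≤N (trans (sym dy≡N∸y) (trans (sym dx≡dy) dx≡N∸x)))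
  ... | inj₁ dx≡x     | inj₂ dy≡N∸y   =
    inj₂ (trans (sym (m∸[m∸n]≡n y≤N)) (cong (N ∸_) (trans (sym dy≡N∸y) (trans (sym dx≡dy) dx≡x))))
  ... | inj₂ dx≡N∸x   | inj₁ dy≡y     = inj₂ (trans (sym dy≡y) (trans (sym dx≡dy) dx≡N∸x))

  x≢N∸x : ∀ {x} → x ≤ N → ¬ (x ≡ N ∸ x)
  x≢N∸x {x} x≤N x≡N∸x = even≢odd x ℓ (begin
    2 * x         ≡⟨ cong (x +_) (+-identityʳ x) ⟩
    x + x         ≡⟨ cong (x +_) x≡N∸x ⟩
    x + (N ∸ x)   ≡⟨ m+[n∸m]≡n x≤N ⟩
    suc (ℓ + ℓ)   ≡⟨ cong (λ y → suc (ℓ + y)) (+-identityʳ ℓ) ⟨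
    suc (2 * ℓ)   ∎)
    where open ≡-Reasoning

  -- ±x ∈ ℤ_N gets colour distance x - 1 ∈ [0, ℓ); `mod ℓ` only makes the function total
  distanceClass : ℕ → Fin ℓ
  distanceClass x = pred (distance x) mod ℓ

  toℕ-distanceClass : ∀ {x} → 0 < x → x < N → toℕ (distanceClass x) ≡ pred (distance x)
  toℕ-distanceClass {x} 0<x x<N = trans (FinP.toℕ-fromℕ< _) (m<n⇒m%n≡m (begin-strict
    pred (distance x)        <⟨ ≤-reflexive (suc-pred (distance x) {{>-nonZero (distance>0 0<x x<N)}}) ⟩
    distance x               ≤⟨ distance≤ℓ (<⇒≤ x<N) ⟩
    ℓ                        ∎))
    where open ≤-Reasoning

  distanceClass-injective : ∀ {x y} → 0 < x → x < N → 0 < y → y < N →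
    distanceClass x ≡ distanceClass y → y ≡ x ⊎ y ≡ N ∸ x
  distanceClass-injective {x} {y} 0<x x<N 0<y y<N cx≡cy = distance-injective (<⇒≤ x<N) (<⇒≤ y<N) (begin
    distance x               ≡⟨ suc-pred (distance x) {{>-nonZero (distance>0 0<x x<N)}} ⟨
    suc (pred (distance x))  ≡⟨ cong suc (trans (sym (toℕ-distanceClass 0<x x<N)) (trans (cong toℕ cx≡cy) (toℕ-distanceClass 0<y y<N))) ⟩
    suc (pred (distance y))  ≡⟨ suc-pred (distance y) {{>-nonZero (distance>0 0<y y<N)}} ⟩
    distance y               ∎)
    where open ≡-Reasoning

  distanceClass-reflect : ∀ {x} → x ≤ N → distanceClass (N ∸ x) ≡ distanceClass x
  distanceClass-reflect x≤N = cong (λ d → pred d mod ℓ) (distance-reflect x≤N)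

  1+toℕ<N : (k : Fin ℓ) → suc (toℕ k) < N
  1+toℕ<N k = s≤s (≤-trans (FinP.toℕ<n k) (m≤m+n ℓ ℓ))

  distanceClass-suc : (k : Fin ℓ) → distanceClass (suc (toℕ k)) ≡ k
  distanceClass-suc k = FinP.toℕ-injective (begin
    toℕ (distanceClass (suc K))     ≡⟨ toℕ-distanceClass z<s (1+toℕ<N k) ⟩
    pred (distance (suc K))         ≡⟨ cong pred (m≤n⇒m⊓n≡m 1+K≤N∸1+K) ⟩
    K                               ∎)
    where
    open ≡-Reasoning
    K : ℕ
    K = toℕ k
    K<ℓ : K < ℓ
    K<ℓ = FinP.toℕ<n k
    1+K≤N∸1+K : suc K ≤ N ∸ suc K
    1+K≤N∸1+K = ≤-trans K<ℓ (≤-trans (m≤m+n ℓ (ℓ ∸ K)) (≤-reflexive (sym (+-∸-assoc ℓ (<⇒≤ K<ℓ)))))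

  colouring : Fin N → Fin N → Fin ℓ
  colouring a b = distanceClass (diffMod N a b)

  colouring-isEdgeColouring : IsEdgeColouring N ℓ colouring
  colouring-isEdgeColouring a b a≢b = sym (begin
    distanceClass (diffMod N b a)              ≡⟨ cong distanceClass (diffMod-swap a b a≢b) ⟩
    distanceClass (N ∸ diffMod N a b)          ≡⟨ distanceClass-reflect (<⇒≤ (diffMod<N a b)) ⟩
    distanceClass (diffMod N a b)              ∎)
    where open ≡-Reasoning

  colourNeighbour-at : (a b : Fin N) {k : Fin ℓ} → 0 < diffMod N a b → distanceClass (diffMod N a b) ≡ k →
    ColourNeighbour colouring a k b
  colourNeighbour-at a b 0<d colour≡k =
    (λ b≡a → <⇒≢ 0<d (sym (trans (cong (diffMod N a) b≡a) (diffMod-self a)))) , colour≡k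

  colouring-degree : ∀ a k → 2 ≤ colourDegree colouring a k
  colouring-degree a k =
    let b₁ , a-b₁ = diffMod-surjective a (suc K) 1+K<N
        b₂ , a-b₂ = diffMod-surjective a (N ∸ suc K) (∸-monoʳ-< z<s (<⇒≤ 1+K<N))
        b₁≢b₂ : ¬ (b₁ ≡ b₂)
        b₁≢b₂ b₁≡b₂ = x≢N∸x (<⇒≤ 1+K<N) (trans (sym a-b₁) (trans (cong (diffMod N a) b₁≡b₂) a-b₂))
    in colourDegree-lowerBound colouring a k ((b₁≢b₂ ∷ []) ∷ [] ∷ [])
         ( colourNeighbour-at a b₁ (subst (0 <_) (sym a-b₁) z<s)
                                  (trans (cong distanceClass a-b₁) (distanceClass-suc k))
         ∷ colourNeighbour-at a b₂ (subst (0 <_) (sym a-b₂) (m<n⇒0<n∸m 1+K<N))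
                                  (trans (cong distanceClass a-b₂) (trans (distanceClass-reflect (<⇒≤ 1+K<N)) (distanceClass-suc k)))
         ∷ [])
    where
    K : ℕ
    K = toℕ k
    1+K<N : suc K < N
    1+K<N = 1+toℕ<N k

  rainbow⇒perfectDifferenceSet : {q : ℕ} → ℓ ≤ q C 2 → RainbowKq q colouring →
    Σ (Subset N) (λ A → ∣ A ∣ ≡ q × IsPerfectDifferenceSet N A)
  rainbow⇒perfectDifferenceSet ℓ≤ (f , f-injective , rainbow) = image f , ∣image∣ f (f-injective _ _) , isPDS
    where
    f-distinct : ∀ {i j} → ¬ (i ≡ j) → ¬ (f i ≡ f j)
    f-distinct i≢j = i≢j ∘ f-injective _ _

    -- the edge of colour distanceClass x joins two vertices at difference ±x
    realise : ∀ {x} → 0 < x → x < N → ∃₂ λ i j → ¬ (i ≡ j) × diffMod N (f i) (f j) ≡ x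
    realise {x} 0<x x<N with i , j , i≢j , colour≡ ← rainbow⇒allColours colouring f ℓ≤ rainbow (distanceClass x)
      with distanceClass-injective (diffMod>0 _ _ (f-distinct i≢j)) (diffMod<N (f i) (f j)) 0<x x<N colour≡
    ... | inj₁ x≡d = i , j , i≢j , sym x≡d
    ... | inj₂ x≡N∸d = j , i , i≢j ∘ sym , trans (diffMod-swap (f i) (f j) (f-distinct i≢j)) (sym x≡N∸d)

    isPDS : IsPerfectDifferenceSet N (image f)
    isPDS x x≢0 with i , j , i≢j , d≡x ← realise (n≢0⇒n>0 x≢0) (FinP.toℕ<n x)
      = (f i , f j) , (∈-image⁺ f i , ∈-image⁺ f j , d≡x) , unique
      where
      unique : (a b : Fin N) → a ∈ₛ image f → b ∈ₛ image f → diffMod N a b ≡ toℕ x → a ≡ f i × b ≡ f j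
      unique a b a∈ b∈ d'≡x with ∈-image⁻ f a∈ | ∈-image⁻ f b∈
      ... | i' , refl | j' , refl with i' FinP.≟ j'
      ... | yes refl = contradiction (trans (sym d'≡x) (diffMod-self (f i'))) x≢0
      ... | no i'≢j' with rainbow i' j' i j i'≢j' i≢j (cong distanceClass (trans d'≡x (sym d≡x)))
      ...   | inj₁ (refl , refl) = refl , refl
      ...   | inj₂ (refl , refl) = ⊥-elim (x≢N∸x (<⇒≤ (FinP.toℕ<n x))
                (trans (sym d'≡x) (trans (diffMod-swap (f i) (f j) (f-distinct i≢j)) (cong (N ∸_) d≡x))))

  tower : ∀ j → Fin (N ^ j) → Fin (N ^ j) → Fin ℓ
  tower zero    _ _ = 0 mod ℓ  -- K₁ has no edges
  tower (suc j)     = colouring ⊗ tower j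

  tower-isEdgeColouring : ∀ j → IsEdgeColouring (N ^ j) ℓ (tower j)
  tower-isEdgeColouring zero    _ _ _ = refl
  tower-isEdgeColouring (suc j)       = ⊗-isEdgeColouring colouring-isEdgeColouring (tower-isEdgeColouring j)

  -- a vertex sees each colour on all of two other blocks of size N ^ j, and inside its own block
  degree : ℕ → ℕ
  degree zero    = 0
  degree (suc j) = 2 * N ^ j + degree j

  tower-degree : ∀ j v k → degree j ≤ colourDegree (tower j) v k
  tower-degree zero    _ _ = z≤n
  tower-degree (suc j) v k =
    subst (λ u → degree (suc j) ≤ colourDegree (tower (suc j)) u k) (FinP.combine-remQuot {N} (N ^ j) v)
      (⊗-colourDegree a x k (colouring-degree a k) (tower-degree j x k))
    where
    a : Fin N
    a = proj₁ (remQuot (N ^ j) v)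
    x : Fin (N ^ j)
    x = proj₂ (remQuot (N ^ j) v)

  tower-noRainbow : {q : ℕ} → 2 ≤ q → ¬ RainbowKq q colouring → ∀ j → ¬ RainbowKq q (tower j)
  tower-noRainbow 2≤q _         zero    (f , f-injective , _) = <⇒≱ 2≤q (FinP.injective⇒≤ (f-injective _ _))
  tower-noRainbow 2≤q noRainbow (suc j) rainbow = [ noRainbow , tower-noRainbow 2≤q noRainbow j ] (⊗-rainbow rainbow)

  N^j≡1+degree*ℓ : ∀ j → N ^ j ≡ 1 + degree j * ℓ
  N^j≡1+degree*ℓ zero    = refl
  N^j≡1+degree*ℓ (suc j) = begin
    N * N ^ j                              ≡⟨ cong (N *_) IH ⟩
    N * (1 + d * ℓ)                        ≡⟨ identity ℓ d ⟩
    1 + (2 * (1 + d * ℓ) + d) * ℓ          ≡⟨ cong (λ p → 1 + (2 * p + d) * ℓ) IH ⟨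
    1 + (2 * N ^ j + d) * ℓ                ∎
    where
    open ≡-Reasoning
    d : ℕ
    d = degree j
    IH : N ^ j ≡ 1 + d * ℓ
    IH = N^j≡1+degree*ℓ j
    identity : ∀ ℓ d → suc (ℓ + ℓ) * (1 + d * ℓ) ≡ 1 + (2 * (1 + d * ℓ) + d) * ℓ
    identity = solve-∀

  floorDiv-degree : ∀ j → floorDiv (N ^ j ∸ 1) ℓ ≡ degree j
  floorDiv-degree j = begin
    floorDiv (N ^ j ∸ 1) ℓ      ≡⟨ cong (λ n → floorDiv (n ∸ 1) ℓ) (N^j≡1+degree*ℓ j) ⟩
    floorDiv (degree j * ℓ) ℓ   ≡⟨ floorDiv≡/ (degree j * ℓ) ℓ ⟩
    degree j * ℓ / ℓ            ≡⟨ m*n/n≡m (degree j) ℓ ⟩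
    degree j                    ∎
    where open ≡-Reasoning

  n≤degree : ∀ j → j ≤ degree j
  n≤degree zero    = z≤n
  n≤degree (suc j) = +-mono-≤ (≤-trans (m^n>0 N j) (m≤m+n (N ^ j) (N ^ j + 0))) (n≤degree j)

  tower-dInfinity : {q : ℕ} → 2 ≤ q → ¬ RainbowKq q colouring → ∀ m →
    Σ ℕ (λ n → m ≤ n × Σ ℕ (λ t → n ≡ 1 + t * ℓ) ×
      Σ (Fin n → Fin n → Fin ℓ) (λ c → IsLDColouring n ℓ (floorDiv (n ∸ 1) ℓ) c × ¬ RainbowKq q c))
  tower-dInfinity 2≤q noRainbow m =
    N ^ j , m≤N^j , (degree j , N^j≡1+degree*ℓ j) , tower j ,
    isLDColouring (tower-isEdgeColouring j) degree≤ (subst (1 ≤_) (sym (floorDiv-degree j)) (≤-trans (s≤s z≤n) (n≤degree j)))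
                  (fromℕ< (m^n>0 N j)) ,
    tower-noRainbow 2≤q noRainbow j
    where
    j : ℕ
    j = suc m
    degree≤ : ∀ v k → floorDiv (N ^ j ∸ 1) ℓ ≤ colourDegree (tower j) v k
    degree≤ v k = subst (_≤ colourDegree (tower j) v k) (sym (floorDiv-degree j)) (tower-degree j v k)
    m≤N^j : m ≤ N ^ j
    m≤N^j = begin
      m                    ≤⟨ n≤1+n m ⟩
      j                    ≤⟨ n≤degree j ⟩
      degree j             ≤⟨ m≤m*n (degree j) ℓ ⟩
      degree j * ℓ         ≤⟨ n≤1+n _ ⟩
      1 + degree j * ℓ     ≡⟨ N^j≡1+degree*ℓ j ⟨
      N ^ j                ∎
      where open ≤-Reasoning

lemma5 : (q : ℕ) → 2 ≤ q → ¬ HasPDS q →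
    (m : ℕ) → Σ ℕ (λ n → m ≤ n × Σ ℕ (λ t → n ≡ 1 + t * (q C 2)) × dInfinityKq n q)
lemma5 q 2≤q noPDS = tower-dInfinity 2≤q (noPDS ∘ hasPDS ∘ rainbow⇒perfectDifferenceSet ≤-refl)
  where
  instance
    qC2-nonZero : NonZero (q C 2)
    qC2-nonZero = >-nonZero (nC2>0 2≤q)
  open DifferenceColouring (q C 2)
  hasPDS : Σ (Subset N) (λ A → ∣ A ∣ ≡ q × IsPerfectDifferenceSet N A) → HasPDS q
  hasPDS = subst (λ M → Σ (Subset M) (λ A → ∣ A ∣ ≡ q × IsPerfectDifferenceSet M A)) (sym (n*n∸n+1≡1+nC2+nC2 q))
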